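{- Let $\lambda$ and $\pi$ be two partitions of $[n]$ with the same number $k$ of blocks. If the statistic $al$ is equidistributed on the first two levels of $\mathcal{T}(\lambda)$ and $\mathcal{T}(\pi)$, i.e. $al(\mathcal{T}(\lambda,l))=al(\mathcal{T}(\pi,l))$ as multisets for $l=0,1$, then $al(\mathcal{T}(\lambda,l,m))=al(\mathcal{T}(\pi,l,m))$ as multisets for all $l,m\ge0$.
   Context: A partition of $[n]$ is represented as a graph on $[n]$ whose arcs join consecutive elements of each block (a block $\{a_1<\dots<a_j\}$ gives arcs $(a_1,a_2),\dots,(a_{j-1},a_j)$). Two arcs $(i_1,j_1),(i_2,j_2)$ with $i_1<i_2$ form a crossing if $i_1<i_2<j_1<j_2$, a nesting if $i_1<i_2<j_2<j_1$, and an alignment otherwise; $al(\mu)$ is the number of (unordered) pairs of arcs of $\mu$ forming an alignment. The tree of partitions has as root the empty partition, and a partition $\mu$ of $[N+1]$ is a child of a partition $\nu$ of $[N]$ iff the restriction of $\mu$ to $\{2,\dots,N+1\}$ is order-isomorphic to $\nu$. $\mathcal{T}(\lambda)$ is the subtree rooted at $\lambda$, $\mathcal{T}(\lambda,l)$ its set of nodes at level $l$ (the partitions of $[n+l]$ whose restriction to the last $n$ elements is order-isomorphic to $\lambda$), and $\mathcal{T}(\lambda,l,m)$ those with $m$ blocks. -}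

module Defs where

open import Data.Nat using (ℕ; zero; suc; _+_; _≤_; _<ᵇ_; _≡ᵇ_)
open import Data.Bool using (Bool; true; false; if_then_else_; not; _∧_)
open import Data.List using (List; []; _∷_; _++_; [_]; length; map; filter; drop; upTo; concatMap)
open import Data.List.Properties using (≡-dec)
open import Data.Nat.Properties using (_≟_)
open import Data.Product using (_×_; _,_)
open import Data.Unit using (⊤)
open import Relation.Binary.PropositionalEquality using (_≡_)

-- Set partitions of [N] are encoded canonically by restricted growth
-- functions (RGFs): a list (b₁,…,b_N) with b₁ = 0 and
-- b_{i+1} ≤ 1 + max(b₁,…,b_i); element i lies in block number b_i,
-- blocks being numbered in order of their minima (0-based).
-- Positions are 0-based: element i of [N] is at position i-1.

-- k = number of blocks opened so far
nextCount : ℕ → ℕ → ℕ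
nextCount k b = if b ≡ᵇ k then suc k else k

RGFFrom : ℕ → List ℕ → Set
RGFFrom k []       = ⊤
RGFFrom k (b ∷ bs) = (b ≤ k) × RGFFrom (nextCount k b) bs

IsPartition : ℕ → List ℕ → Set
IsPartition n μ = (length μ ≡ n) × RGFFrom 0 μ

blocksFrom : ℕ → List ℕ → ℕ
blocksFrom k []       = k
blocksFrom k (b ∷ bs) = blocksFrom (nextCount k b) bs

blocks : List ℕ → ℕ
blocks = blocksFrom 0

rgfsFrom : ℕ → ℕ → List (List ℕ)
rgfsFrom zero    k = [ [] ]
rgfsFrom (suc r) k = concatMap (λ b → map (b ∷_) (rgfsFrom r (nextCount k b))) (upTo (suc k))

partitions : ℕ → List (List ℕ)
partitions N = rgfsFrom N 0

-- For the RGF of the restriction of μ to a final segment, apply std to the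
-- corresponding suffix; this yields the RGF of the order-isomorphic
-- partition of [n].
indexOf : ℕ → List ℕ → ℕ → Bool × ℕ
indexOf x []       i = false , i
indexOf x (y ∷ ys) i = if x ≡ᵇ y then (true , i) else indexOf x ys (suc i)

stdGo : List ℕ → List ℕ → List ℕ
stdGo seen []       = []
stdGo seen (x ∷ xs) with indexOf x seen 0
... | true  , i = i ∷ stdGo seen xs
... | false , i = i ∷ stdGo (seen ++ [ x ]) xs

std : List ℕ → List ℕ
std = stdGo []

-- Arcs: (i , j) with i < j consecutive elements of a block.
nextSame : ℕ → List ℕ → ℕ → Bool × ℕ
nextSame b []       j = false , j
nextSame b (c ∷ cs) j = if b ≡ᵇ c then (true , j) else nextSame b cs (suc j)

arcsFrom : ℕ → List ℕ → List (ℕ × ℕ)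
arcsFrom i []       = []
arcsFrom i (b ∷ bs) with nextSame b bs (suc i)
... | true  , j = (i , j) ∷ arcsFrom (suc i) bs
... | false , _ = arcsFrom (suc i) bs

arcs : List ℕ → List (ℕ × ℕ)
arcs = arcsFrom 0

-- for arcs with i₁ < i₂
crossing nesting : ℕ × ℕ → ℕ × ℕ → Bool
crossing (i₁ , j₁) (i₂ , j₂) = (i₁ <ᵇ i₂) ∧ (i₂ <ᵇ j₁) ∧ (j₁ <ᵇ j₂)
nesting  (i₁ , j₁) (i₂ , j₂) = (i₁ <ᵇ i₂) ∧ (i₂ <ᵇ j₂) ∧ (j₂ <ᵇ j₁)

alignment : ℕ × ℕ → ℕ × ℕ → Bool
alignment a@(i₁ , _) b@(i₂ , _) =
  if i₁ <ᵇ i₂ then not (crossing a b ∨' nesting a b)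
              else not (crossing b a ∨' nesting b a)
  where
  _∨'_ : Bool → Bool → Bool
  true  ∨' _ = true
  false ∨' y = y

countAl : ℕ × ℕ → List (ℕ × ℕ) → ℕ
countAl a []       = 0
countAl a (b ∷ bs) = (if alignment a b then 1 else 0) + countAl a bs

alPairs : List (ℕ × ℕ) → ℕ
alPairs []       = 0
alPairs (a ∷ as) = countAl a as + alPairs as

al : List ℕ → ℕ
al μ = alPairs (arcs μ)

-- 𝒯(λ, l): partitions of [n + l] whose restriction to the last n elements
-- is order-isomorphic to λ (n = length λ)
level : List ℕ → ℕ → List (List ℕ)
level lam l = filter (λ μ → ≡-dec _≟_ (std (drop l μ)) lam) (partitions (length lam + l))

levelBlocks : List ℕ → ℕ → ℕ → List (List ℕ)
levelBlocks lam l m = filter (λ μ → blocks μ ≟ m) (level lam l)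

-- al(𝒯(λ,l)) and al(𝒯(λ,l,m)) as multisets (lists up to permutation)
alLevel : List ℕ → ℕ → List ℕ
alLevel lam l = map al (level lam l)

alLevelBlocks : List ℕ → ℕ → ℕ → List ℕ
alLevelBlocks lam l m = map al (levelBlocks lam l m)

-- Encode the tree of partitions on words of labels: the children of μ are obtained by
-- prepending a fresh label or the label of a block of μ, and standardising.  Call the gain of a
-- block the number of arcs aligned with the arc that a new first element joining it creates.
-- The profile of μ (al μ, its number A of arcs, and the multiset of gains of its blocks)
-- determines the profiles of its children: a new singleton block adds a block of gain A;
-- joining a block of gain c adds c to al and one arc, and that block's gain becomes A + 1,
-- while all other gains stay the same.  So the profiles along 𝒯(λ), which carry al and the
-- number of blocks, depend only on the profile of λ.  Level 0 of 𝒯(λ) gives al λ, level 1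
-- gives the gains, and A is n minus the number of blocks.
module Submission where

open import Data.Bool using (Bool; true; false; if_then_else_)
open import Data.Empty using (⊥; ⊥-elim)
open import Data.List using (List; []; _∷_; _++_; [_]; length; map; filter; drop; upTo; concatMap; deduplicate)
open import Data.List.Membership.Propositional using (_∈_; _∉_; find; lose)
open import Data.List.Membership.Propositional.Properties
  using (∈-++⁺ˡ; ∈-++⁺ʳ; ∈-++⁻; ∈-map⁺; ∈-map⁻; ∈-concatMap⁺; ∈-concatMap⁻; ∈-upTo⁺; ∈-upTo⁻;
         ∈-filter⁺; ∈-filter⁻; ∈-deduplicate⁺; ∈-deduplicate⁻)
open import Data.List.Membership.Propositional.Properties.WithK using (unique∧set⇒bag)
open import Data.List.Properties
  using (++-assoc; ++-identityʳ; map-++; map-∘; map-id; map-cong; map-cong-local; length-map; length-++;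
         length-upTo; upTo-∷ʳ; drop-map; ∷-injectiveˡ; ∷-injectiveʳ; filter-all; filter-accept;
         filter-reject; ≡-dec; map-concatMap; concatMap-map)
open import Data.List.Relation.Binary.BagAndSetEquality using (∼bag⇒↭)
open import Data.List.Relation.Binary.Permutation.Propositional
  using (_↭_; ↭-refl; ↭-sym; ↭-trans; ↭-reflexive; prep; swap; ↭⇒↭ₛ; module PermutationReasoning)
import Data.List.Relation.Binary.Permutation.Propositional as ↭
open import Data.List.Relation.Binary.Permutation.Propositional.Properties
  using (++⁺; ++⁺ˡ; shifts; ↭-length; ↭-singleton-inv)
import Data.List.Relation.Binary.Permutation.Propositional.Properties as ↭ₚ
open import Data.List.Relation.Binary.Pointwise using (Pointwise-≡⇒≡)
open import Data.List.Relation.Unary.All as All using (All)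
import Data.List.Relation.Unary.AllPairs as AllPairs
open import Data.List.Relation.Unary.Any using (here; there)
open import Data.List.Relation.Unary.Sorted.TotalOrder.Properties using (↗↭↗⇒≋)
open import Data.List.Relation.Unary.Unique.Propositional using (Unique)
import Data.List.Relation.Unary.Unique.Propositional.Properties as Unique
open import Data.List.Relation.Unary.Unique.DecPropositional.Properties using (deduplicate-!)
open import Data.Nat using (ℕ; zero; suc; _+_; _∸_; _≤_; _<_; s≤s; s≤s⁻¹; z≤n; _≡ᵇ_; _<ᵇ_)
open import Data.Nat.ListAction using (sum)
open import Data.Nat.Properties
  using (_≟_; ≤-decTotalOrder; ≤-totalOrder; ≤-refl; ≤-trans; ≤-antisym; <⇒≤; <-irrefl; ≮⇒≥;
         <ᵇ-reflects-<; +-suc; +-identityʳ; +-comm; +-cancelʳ-≡; m≤m+n; m≤n+m; m≤n⇒m<n∨m≡n;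
         m+n∸n≡m; 0≢1+n; suc-injective)
open import Data.List.Membership.DecPropositional _≟_ using (_∈?_)
open import Data.List.Sort ≤-decTotalOrder using (sort; sort-↭; sort-↗)
open import Data.Product using (_×_; _,_; proj₁; proj₂; ∃-syntax; uncurry)
import Data.Product as Product
open import Data.Sum using (_⊎_; inj₁; inj₂; map₂; [_,_]′)
open import Function using (_∘_)
open import Function.Bundles using (mk⇔)
open import Relation.Binary.PropositionalEquality
  using (_≡_; _≢_; refl; sym; trans; cong; cong₂; subst; ≢-sym; module ≡-Reasoning)
open import Relation.Nullary using (yes; no; proof)
open import Relation.Nullary.Decidable using (dec-true; dec-false; ¬?)
open import Relation.Nullary.Reflects using (Reflects; ofʸ; ofⁿ)

open import Defs

≡ᵇ-reflects : ∀ m n → Reflects (m ≡ n) (m ≡ᵇ n)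
≡ᵇ-reflects m n = proof (m ≟ n)

≡ᵇ-refl : ∀ n → (n ≡ᵇ n) ≡ true
≡ᵇ-refl n = dec-true (n ≟ n) refl

≢⇒≡ᵇ-false : ∀ {m n} → m ≢ n → (m ≡ᵇ n) ≡ false
≢⇒≡ᵇ-false {m} {n} = dec-false (m ≟ n)

≡ᵇ-injectiveOn : ∀ (f g : ℕ → ℕ) {x y} → g (f x) ≡ x → g (f y) ≡ y → (f x ≡ᵇ f y) ≡ (x ≡ᵇ y)
≡ᵇ-injectiveOn f g {x} {y} gfx gfy with x ≟ y
... | yes refl = trans (≡ᵇ-refl (f x)) (sym (≡ᵇ-refl x))
... | no x≢y = trans (≢⇒≡ᵇ-false (λ e → x≢y (trans (sym gfx) (trans (cong g e) gfy)))) (sym (≢⇒≡ᵇ-false x≢y))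

module _ {A : Set} where

  removals : List A → List (A × List A)
  removals [] = []
  removals (c ∷ cs) = (c , cs) ∷ map (Product.map₂ (c ∷_)) (removals cs)

  map-proj₁-removals : ∀ cs → map proj₁ (removals cs) ≡ cs
  map-proj₁-removals [] = refl
  map-proj₁-removals (c ∷ cs) = cong (c ∷_) (trans (sym (map-∘ (removals cs))) (map-proj₁-removals cs))

module _ {A B : Set} where

  ∈-concatMap⁻′ : ∀ (f : A → List B) xs {z} → z ∈ concatMap f xs → ∃[ x ] x ∈ xs × z ∈ f x
  ∈-concatMap⁻′ f xs z∈ = find (∈-concatMap⁻ f {xs = xs} z∈)

  ∈-concatMap⁺′ : ∀ (f : A → List B) {xs x z} → x ∈ xs → z ∈ f x → z ∈ concatMap f xs
  ∈-concatMap⁺′ f x∈xs z∈fx = ∈-concatMap⁺ f (lose x∈xs z∈fx)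

  unique-concatMap : ∀ (f : A → List B) (key : B → A) {xs} → Unique xs →
                     (∀ {x} → x ∈ xs → Unique (f x)) →
                     (∀ {x z} → x ∈ xs → z ∈ f x → key z ≡ x) →
                     Unique (concatMap f xs)
  unique-concatMap f key {[]} _ _ _ = AllPairs.[]
  unique-concatMap f key {x ∷ xs} (x∉xs AllPairs.∷ !xs) !f keyed =
    Unique.++⁺ (!f (here refl)) (unique-concatMap f key !xs (!f ∘ there) (keyed ∘ there)) disjoint
    where
    disjoint : ∀ {z} → z ∈ f x × z ∈ concatMap f xs → ⊥
    disjoint (z∈fx , z∈rest) with y , y∈xs , z∈fy ← ∈-concatMap⁻′ f xs z∈rest =
      All.lookup x∉xs y∈xs (trans (sym (keyed (here refl) z∈fx)) (keyed (there y∈xs) z∈fy))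

  unique-mapOn : ∀ (f : A → B) {xs} → Unique xs →
                 (∀ {x y} → x ∈ xs → y ∈ xs → f x ≡ f y → x ≡ y) → Unique (map f xs)
  unique-mapOn f {[]} _ _ = AllPairs.[]
  unique-mapOn f {x ∷ xs} (x∉xs AllPairs.∷ !xs) inj =
    All.tabulate fresh AllPairs.∷ unique-mapOn f !xs (λ x∈ y∈ → inj (there x∈) (there y∈))
    where
    fresh : ∀ {v} → v ∈ map f xs → f x ≢ v
    fresh v∈ fx≡v with y , y∈xs , refl ← ∈-map⁻ f v∈ = All.lookup x∉xs y∈xs (inj (here refl) (there y∈xs) fx≡v)

  concatMap-resp-↭ : ∀ (f : A → List B) {xs ys} → xs ↭ ys → concatMap f xs ↭ concatMap f ys
  concatMap-resp-↭ f ↭.refl = ↭-refl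
  concatMap-resp-↭ f (↭.prep x p) = ++⁺ˡ (f x) (concatMap-resp-↭ f p)
  concatMap-resp-↭ f (↭.swap x y p) = ↭-trans (shifts (f x) (f y)) (++⁺ˡ (f y) (++⁺ˡ (f x) (concatMap-resp-↭ f p)))
  concatMap-resp-↭ f (↭.trans p q) = ↭-trans (concatMap-resp-↭ f p) (concatMap-resp-↭ f q)

  concatMap-cong-↭ : ∀ {f g : A → List B} → (∀ x → f x ↭ g x) → ∀ xs → concatMap f xs ↭ concatMap g xs
  concatMap-cong-↭ f↭g [] = ↭-refl
  concatMap-cong-↭ f↭g (x ∷ xs) = ++⁺ (f↭g x) (concatMap-cong-↭ f↭g xs)

  map-removals-∷ : ∀ (F : A → List A → B) x xs →
                   map (uncurry F) (removals (x ∷ xs)) ≡ F x xs ∷ map (uncurry λ c r → F c (x ∷ r)) (removals xs)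
  map-removals-∷ F x xs = cong (F x xs ∷_) (sym (map-∘ (removals xs)))

  removals-↭ : ∀ (F : A → List A → B) → (∀ c {r r′} → r ↭ r′ → F c r ≡ F c r′) →
               ∀ {xs ys} → xs ↭ ys → map (uncurry F) (removals xs) ↭ map (uncurry F) (removals ys)
  removals-↭ F resp ↭.refl = ↭-refl
  removals-↭ F resp (↭.trans p q) = ↭-trans (removals-↭ F resp p) (removals-↭ F resp q)
  removals-↭ F resp (↭.prep {xs} {ys} x p) = begin
    map (uncurry F) (removals (x ∷ xs))      ≡⟨ map-removals-∷ F x xs ⟩
    F x xs ∷ map (uncurry Fx) (removals xs)  <⟨ removals-↭ Fx (λ c q → resp c (prep x q)) p ⟩
    F x xs ∷ map (uncurry Fx) (removals ys)  ≡⟨ cong (_∷ map (uncurry Fx) (removals ys)) (resp x p) ⟩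
    F x ys ∷ map (uncurry Fx) (removals ys)  ≡⟨ map-removals-∷ F x ys ⟨
    map (uncurry F) (removals (x ∷ ys))      ∎
    where
    open PermutationReasoning
    Fx : A → List A → B
    Fx c r = F c (x ∷ r)
  removals-↭ F resp (↭.swap {xs} {ys} x y p) = begin
    map (uncurry F) (removals (x ∷ y ∷ xs))
      ≡⟨ trans (map-removals-∷ F x (y ∷ xs)) (cong (F x (y ∷ xs) ∷_) (map-removals-∷ Fx y xs)) ⟩
    F x (y ∷ xs) ∷ F y (x ∷ xs) ∷ map (uncurry Fxy) (removals xs)
      <<⟨ removals-↭ Fxy (λ c q → resp c (prep x (prep y q))) p ⟩
    F y (x ∷ xs) ∷ F x (y ∷ xs) ∷ map (uncurry Fxy) (removals ys)
      ≡⟨ cong₂ (λ u v → u ∷ v ∷ map (uncurry Fxy) (removals ys)) (resp y (prep x p)) (resp x (prep y p)) ⟩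
    F y (x ∷ ys) ∷ F x (y ∷ ys) ∷ map (uncurry Fxy) (removals ys)
      ≡⟨ cong (λ t → F y (x ∷ ys) ∷ F x (y ∷ ys) ∷ t)
              (map-cong (λ (c , r) → resp c (swap x y ↭-refl)) (removals ys)) ⟩
    F y (x ∷ ys) ∷ F x (y ∷ ys) ∷ map (uncurry Fyx) (removals ys)
      ≡⟨ trans (map-removals-∷ F y (x ∷ ys)) (cong (F y (x ∷ ys) ∷_) (map-removals-∷ Fy x ys)) ⟨
    map (uncurry F) (removals (y ∷ x ∷ ys))
      ∎
    where
    open PermutationReasoning
    Fx Fy Fxy Fyx : A → List A → B
    Fx c r = F c (x ∷ r)
    Fy c r = F c (y ∷ r)
    Fxy c r = F c (x ∷ y ∷ r)
    Fyx c r = F c (y ∷ x ∷ r)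

unique-∈⇔⇒↭ : ∀ {A : Set} {xs ys : List A} → Unique xs → Unique ys →
              (∀ {x} → x ∈ xs → x ∈ ys) → (∀ {x} → x ∈ ys → x ∈ xs) → xs ↭ ys
unique-∈⇔⇒↭ !xs !ys to from = ∼bag⇒↭ (unique∧set⇒bag !xs !ys (mk⇔ to from))

sort-↭⇒≡ : ∀ {xs ys} → xs ↭ ys → sort xs ≡ sort ys
sort-↭⇒≡ {xs} {ys} xs↭ys = Pointwise-≡⇒≡ (↗↭↗⇒≋ ≤-totalOrder (sort-↗ xs) (sort-↗ ys)
  (↭⇒↭ₛ (↭-trans (sort-↭ xs) (↭-trans xs↭ys (↭-sym (sort-↭ ys))))))

map-+-cancel-↭ : ∀ a {xs ys} → map (_+ a) xs ↭ map (_+ a) ys → xs ↭ ys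
map-+-cancel-↭ a {xs} {ys} p =
  ↭-trans (↭-reflexive (sym (+-∸ xs))) (↭-trans (↭ₚ.map⁺ (_∸ a) p) (↭-reflexive (+-∸ ys)))
  where
  +-∸ : ∀ zs → map (_∸ a) (map (_+ a) zs) ≡ zs
  +-∸ zs = trans (sym (map-∘ zs)) (trans (map-cong (λ z → m+n∸n≡m z a) zs) (map-id zs))

-- Enumeration of restricted growth functions

rgfsFrom-unique : ∀ r k → Unique (rgfsFrom r k)
rgfsFrom-unique zero k = All.[] AllPairs.∷ AllPairs.[]
rgfsFrom-unique (suc r) k = unique-concatMap extend head (Unique.upTo⁺ (suc k))
  (λ {b} _ → Unique.map⁺ ∷-injectiveʳ (rgfsFrom-unique r (nextCount k b))) head-extend
  where
  extend : ℕ → List (List ℕ)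
  extend b = map (b ∷_) (rgfsFrom r (nextCount k b))
  head : List ℕ → ℕ
  head [] = 0
  head (b ∷ _) = b
  head-extend : ∀ {b ν} → b ∈ upTo (suc k) → ν ∈ extend b → head ν ≡ b
  head-extend {b} _ ν∈ with _ , _ , refl ← ∈-map⁻ (b ∷_) ν∈ = refl

∈-rgfsFrom⁻ : ∀ r k {ν} → ν ∈ rgfsFrom r k → RGFFrom k ν × length ν ≡ r
∈-rgfsFrom⁻ zero k (here refl) = _ , refl
∈-rgfsFrom⁻ (suc r) k ν∈
  with b , b∈ , ν∈′ ← ∈-concatMap⁻′ (λ b → map (b ∷_) (rgfsFrom r (nextCount k b))) (upTo (suc k)) ν∈
  with ν′ , ν′∈ , refl ← ∈-map⁻ (b ∷_) ν∈′
  with rgf , len ← ∈-rgfsFrom⁻ r (nextCount k b) ν′∈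
  = (s≤s⁻¹ (∈-upTo⁻ b∈) , rgf) , cong suc len

∈-rgfsFrom⁺ : ∀ k ν → RGFFrom k ν → ν ∈ rgfsFrom (length ν) k
∈-rgfsFrom⁺ k [] _ = here refl
∈-rgfsFrom⁺ k (b ∷ ν) (b≤k , rgf) =
  ∈-concatMap⁺′ (λ b → map (b ∷_) (rgfsFrom (length ν) (nextCount k b)))
    (∈-upTo⁺ (s≤s b≤k)) (∈-map⁺ (b ∷_) (∈-rgfsFrom⁺ (nextCount k b) ν rgf))

LeftInverseOn : (ℕ → ℕ) → (ℕ → ℕ) → List ℕ → Set
LeftInverseOn g f xs = ∀ {x} → x ∈ xs → g (f x) ≡ x

-- Words that differ by an injective renaming of labels encode the same set partition.
record Relabelling (xs ys : List ℕ) : Set where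
  constructor relabelling
  field
    f g : ℕ → ℕ
    map-f : map f xs ≡ ys
    g∘f : LeftInverseOn g f xs

relabel-sym : ∀ {xs ys} → Relabelling xs ys → Relabelling ys xs
relabel-sym {xs} (relabelling f g refl g∘f) = relabelling g f (g∘f-map xs g∘f) f∘g
  where
  g∘f-map : ∀ zs → LeftInverseOn g f zs → map g (map f zs) ≡ zs
  g∘f-map [] _ = refl
  g∘f-map (z ∷ zs) inv = cong₂ _∷_ (inv (here refl)) (g∘f-map zs (inv ∘ there))
  f∘g : LeftInverseOn f g (map f xs)
  f∘g y∈ with x , x∈ , refl ← ∈-map⁻ f y∈ = cong f (g∘f x∈)

relabel-trans : ∀ {xs ys zs} → Relabelling xs ys → Relabelling ys zs → Relabelling xs zs
relabel-trans {xs} (relabelling f g refl g∘f) (relabelling f′ g′ refl g′∘f′) =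
  relabelling (f′ ∘ f) (g ∘ g′) (map-∘ xs) (λ x∈ → trans (cong g (g′∘f′ (∈-map⁺ f x∈))) (g∘f x∈))

relabel-drop : ∀ n {xs ys} → Relabelling xs ys → Relabelling (drop n xs) (drop n ys)
relabel-drop n {xs} (relabelling f g refl g∘f) = relabelling f g (sym (drop-map n xs)) (g∘f ∘ ∈-drop n)
  where
  ∈-drop : ∀ n {xs : List ℕ} {z} → z ∈ drop n xs → z ∈ xs
  ∈-drop zero z∈ = z∈
  ∈-drop (suc n) {_ ∷ xs} z∈ = there (∈-drop n z∈)

relabel-∷-∈ : ∀ {xs ys x} → Relabelling xs ys → x ∈ xs → ∃[ y ] y ∈ ys × Relabelling (x ∷ xs) (y ∷ ys)
relabel-∷-∈ (relabelling f g refl inv) x∈ =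
  f _ , ∈-map⁺ f x∈ , relabelling f g refl λ { (here refl) → inv x∈ ; (there z∈) → inv z∈ }

relabel-∷-∉ : ∀ {xs ys x y} → Relabelling xs ys → x ∉ xs → y ∉ ys → Relabelling (x ∷ xs) (y ∷ ys)
relabel-∷-∉ {xs} {x = x} {y} (relabelling f g refl inv) x∉ y∉ =
  relabelling f′ g′ (cong₂ _∷_ f′x≡y (map-cong-local (All.tabulate f′-xs))) g′∘f′
  where
  f′ g′ : ℕ → ℕ
  f′ z = if z ≡ᵇ x then y else f z
  g′ w = if w ≡ᵇ y then x else g w
  f′x≡y : f′ x ≡ y
  f′x≡y rewrite ≡ᵇ-refl x = refl
  f′-xs : ∀ {z} → z ∈ xs → f′ z ≡ f z
  f′-xs z∈ rewrite ≢⇒≡ᵇ-false (λ z≡x → x∉ (subst (_∈ xs) z≡x z∈)) = refl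
  g′∘f′ : LeftInverseOn g′ f′ (x ∷ xs)
  g′∘f′ (here refl) rewrite f′x≡y | ≡ᵇ-refl y = refl
  g′∘f′ (there z∈) rewrite f′-xs z∈ | ≢⇒≡ᵇ-false (λ fz≡y → y∉ (subst (_∈ map f xs) fz≡y (∈-map⁺ f z∈))) = inv z∈

relabel-∷-fixed : ∀ {xs x y} → Relabelling (x ∷ xs) (y ∷ xs) → x ∈ xs → x ≡ y
relabel-∷-fixed {xs} (relabelling f g eq _) x∈ = trans (sym (fixes xs (∷-injectiveʳ eq) x∈)) (∷-injectiveˡ eq)
  where
  fixes : ∀ zs → map f zs ≡ zs → ∀ {z} → z ∈ zs → f z ≡ z
  fixes (z ∷ zs) e (here refl) = ∷-injectiveˡ e
  fixes (z ∷ zs) e (there z∈) = fixes zs (∷-injectiveʳ e) z∈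

-- Standardisation

at : List ℕ → ℕ → ℕ
at [] _ = 0
at (x ∷ xs) zero = x
at (x ∷ xs) (suc p) = at xs p

at-∈ : ∀ S {p} → p < length S → at S p ∈ S
at-∈ (x ∷ S) {zero} _ = here refl
at-∈ (x ∷ S) {suc p} (s≤s p<) = there (at-∈ S p<)

length-∷ʳ : ∀ (S : List ℕ) x → length (S ++ [ x ]) ≡ suc (length S)
length-∷ʳ S x = trans (length-++ S) (+-comm (length S) 1)

nextCount-new : ∀ k → nextCount k k ≡ suc k
nextCount-new k = cong (λ c → if c then suc k else k) (≡ᵇ-refl k)

nextCount-old : ∀ {k b} → b < k → nextCount k b ≡ k
nextCount-old {k} {b} b<k = cong (λ c → if c then suc k else k) (≢⇒≡ᵇ-false (λ b≡k → <-irrefl b≡k b<k))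

data IndexOf (x : ℕ) (S : List ℕ) (i : ℕ) : Bool × ℕ → Set where
  found  : ∀ {p j} → j ≡ i + p → p < length S → at S p ≡ x → IndexOf x S i (true , j)
  absent : ∀ {j} → j ≡ i + length S → x ∉ S → IndexOf x S i (false , j)

indexOf-view : ∀ x S i → IndexOf x S i (indexOf x S i)
indexOf-view x [] i = absent (sym (+-identityʳ i)) λ ()
indexOf-view x (y ∷ S) i with x ≡ᵇ y | ≡ᵇ-reflects x y
... | true | ofʸ refl = found (sym (+-identityʳ i)) (s≤s z≤n) refl
... | false | ofⁿ x≢y with indexOf x S (suc i) | indexOf-view x S (suc i)
...   | _ | found {p} eq p< at≡ = found {p = suc p} (trans eq (sym (+-suc i p))) (s≤s p<) at≡
...   | _ | absent eq x∉S =
  absent (trans eq (sym (+-suc i (length S)))) λ { (here x≡y) → x≢y x≡y ; (there x∈S) → x∉S x∈S }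

indexOf-∉ : ∀ x S i → x ∉ S → indexOf x S i ≡ (false , i + length S)
indexOf-∉ x S i x∉S with indexOf x S i | indexOf-view x S i
... | _ | found _ p< at≡ = ⊥-elim (x∉S (subst (_∈ S) at≡ (at-∈ S p<)))
... | _ | absent refl _ = refl

indexOf-++ : ∀ x S T i → x ∈ S → indexOf x (S ++ T) i ≡ indexOf x S i
indexOf-++ x (y ∷ S) T i x∈ with x ≡ᵇ y | ≡ᵇ-reflects x y | x∈
... | true | _ | _ = refl
... | false | ofⁿ x≢y | here x≡y = ⊥-elim (x≢y x≡y)
... | false | _ | there x∈S = indexOf-++ x S T (suc i) x∈S

indexOf-∷ʳ : ∀ x S i → x ∉ S → indexOf x (S ++ [ x ]) i ≡ (true , i + length S)
indexOf-∷ʳ x [] i _ rewrite ≡ᵇ-refl x = cong (true ,_) (sym (+-identityʳ i))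
indexOf-∷ʳ x (y ∷ S) i x∉ rewrite ≢⇒≡ᵇ-false (x∉ ∘ here) =
  trans (indexOf-∷ʳ x S (suc i) (x∉ ∘ there)) (cong (true ,_) (sym (+-suc i (length S))))

indexOf-upTo : ∀ {b} k i → b < k → indexOf b (upTo k) i ≡ (true , i + b)
indexOf-upTo {b} (suc k) i b<1+k =
  trans (cong (λ S → indexOf b S i) (sym (upTo-∷ʳ k))) (split (m≤n⇒m<n∨m≡n (s≤s⁻¹ b<1+k)))
  where
  split : b < k ⊎ b ≡ k → indexOf b (upTo k ++ [ k ]) i ≡ (true , i + b)
  split (inj₁ b<k) = trans (indexOf-++ b (upTo k) [ k ] i (∈-upTo⁺ b<k)) (indexOf-upTo k i b<k)
  split (inj₂ refl) = trans (indexOf-∷ʳ b (upTo b) i (<-irrefl refl ∘ ∈-upTo⁻))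
                            (cong (λ n → true , i + n) (length-upTo b))

stdGo-upTo : ∀ k μ → RGFFrom k μ → stdGo (upTo k) μ ≡ μ
stdGo-upTo k [] _ = refl
stdGo-upTo k (b ∷ μ) (b≤k , rgf) with m≤n⇒m<n∨m≡n b≤k
... | inj₁ b<k rewrite indexOf-upTo k 0 b<k | nextCount-old b<k = cong (b ∷_) (stdGo-upTo k μ rgf)
... | inj₂ refl rewrite indexOf-∉ b (upTo b) 0 (<-irrefl refl ∘ ∈-upTo⁻) | nextCount-new b =
  cong₂ _∷_ (length-upTo b) (trans (cong (λ S → stdGo S μ) (upTo-∷ʳ b)) (stdGo-upTo (suc b) μ rgf))

std-RGF : ∀ μ → RGFFrom 0 μ → std μ ≡ μ
std-RGF = stdGo-upTo 0

stdGo-RGF : ∀ seen xs → RGFFrom (length seen) (stdGo seen xs)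
stdGo-RGF seen [] = _
stdGo-RGF seen (x ∷ xs) with indexOf x seen 0 | indexOf-view x seen 0
... | _ | found refl p< _ =
  <⇒≤ p< , subst (λ k → RGFFrom k (stdGo seen xs)) (sym (nextCount-old p<)) (stdGo-RGF seen xs)
... | _ | absent refl _ =
  ≤-refl , subst (λ k → RGFFrom k (stdGo (seen ++ [ x ]) xs))
                 (sym (trans (nextCount-new (length seen)) (sym (length-∷ʳ seen x))))
                 (stdGo-RGF (seen ++ [ x ]) xs)

stdLabels : List ℕ → List ℕ → List ℕ
stdLabels seen [] = seen
stdLabels seen (x ∷ xs) with indexOf x seen 0
... | true , _ = stdLabels seen xs
... | false , _ = stdLabels (seen ++ [ x ]) xs

stdLabels-extends : ∀ seen xs → ∃[ T ] stdLabels seen xs ≡ seen ++ T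
stdLabels-extends seen [] = [] , sym (++-identityʳ seen)
stdLabels-extends seen (x ∷ xs) with indexOf x seen 0
... | true , _ = stdLabels-extends seen xs
... | false , _ with T , eq ← stdLabels-extends (seen ++ [ x ]) xs = x ∷ T , trans eq (++-assoc seen [ x ] T)

∈-stdLabels-seen : ∀ seen xs {z} → z ∈ seen → z ∈ stdLabels seen xs
∈-stdLabels-seen seen xs z∈ with T , eq ← stdLabels-extends seen xs = subst (_ ∈_) (sym eq) (∈-++⁺ˡ z∈)

∈-stdLabels⁺ : ∀ seen xs {z} → z ∈ xs → z ∈ stdLabels seen xs
∈-stdLabels⁺ seen (x ∷ xs) z∈ with indexOf x seen 0 | indexOf-view x seen 0 | z∈
... | _ | found _ p< refl | here refl = ∈-stdLabels-seen seen xs (at-∈ seen p<)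
... | _ | absent _ _ | here refl = ∈-stdLabels-seen (seen ++ [ x ]) xs (∈-++⁺ʳ seen (here refl))
... | _ | found _ _ _ | there z∈xs = ∈-stdLabels⁺ seen xs z∈xs
... | _ | absent _ _ | there z∈xs = ∈-stdLabels⁺ (seen ++ [ x ]) xs z∈xs

∈-stdLabels⁻ : ∀ seen xs {z} → z ∈ stdLabels seen xs → z ∈ seen ⊎ z ∈ xs
∈-stdLabels⁻ seen [] z∈ = inj₁ z∈
∈-stdLabels⁻ seen (x ∷ xs) z∈ with indexOf x seen 0
... | true , _ = map₂ there (∈-stdLabels⁻ seen xs z∈)
... | false , _ with ∈-stdLabels⁻ (seen ++ [ x ]) xs z∈
...   | inj₂ z∈xs = inj₂ (there z∈xs)
...   | inj₁ z∈seen′ = map₂ (λ { (here z≡x) → here z≡x }) (∈-++⁻ seen z∈seen′)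

stdLabels-unique : ∀ seen xs → Unique seen → Unique (stdLabels seen xs)
stdLabels-unique seen [] !seen = !seen
stdLabels-unique seen (x ∷ xs) !seen with indexOf x seen 0 | indexOf-view x seen 0
... | _ | found _ _ _ = stdLabels-unique seen xs !seen
... | _ | absent _ x∉ = stdLabels-unique (seen ++ [ x ]) xs
  (Unique.++⁺ !seen (All.[] AllPairs.∷ AllPairs.[]) λ { (x∈ , here refl) → x∉ x∈ })

position : List ℕ → ℕ → ℕ
position S x = proj₂ (indexOf x S 0)

position-stdLabels : ∀ seen xs {x} → x ∈ seen → position (stdLabels seen xs) x ≡ position seen x
position-stdLabels seen xs {x} x∈ with T , eq ← stdLabels-extends seen xs rewrite eq =
  cong proj₂ (indexOf-++ x seen T 0 x∈)

stdGo-position : ∀ seen xs → stdGo seen xs ≡ map (position (stdLabels seen xs)) xs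
stdGo-position seen [] = refl
stdGo-position seen (x ∷ xs) with indexOf x seen 0 in eq | indexOf-view x seen 0
... | true , p | found _ p< at≡ =
  cong₂ _∷_ (sym (trans (position-stdLabels seen xs (subst (_∈ seen) at≡ (at-∈ seen p<))) (cong proj₂ eq)))
            (stdGo-position seen xs)
... | false , _ | absent refl x∉ =
  cong₂ _∷_ (sym (trans (position-stdLabels (seen ++ [ x ]) xs (∈-++⁺ʳ seen (here refl)))
                        (cong proj₂ (indexOf-∷ʳ x seen 0 x∉))))
            (stdGo-position (seen ++ [ x ]) xs)

relabel-std : ∀ xs → Relabelling xs (std xs)
relabel-std xs = relabelling (position L) (at L) (sym (stdGo-position [] xs)) at∘position
  where
  L = stdLabels [] xs
  at∘position : LeftInverseOn (at L) (position L) xs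
  at∘position {x} x∈ with indexOf x L 0 | indexOf-view x L 0
  ... | _ | found refl _ at≡ = at≡
  ... | _ | absent _ x∉ = ⊥-elim (x∉ (∈-stdLabels⁺ [] xs x∈))

length-std : ∀ xs → length (std xs) ≡ length xs
length-std xs = trans (cong length (stdGo-position [] xs)) (length-map _ xs)

indexOf-map : ∀ (f g : ℕ → ℕ) x S i → g (f x) ≡ x → LeftInverseOn g f S →
              indexOf (f x) (map f S) i ≡ indexOf x S i
indexOf-map f g x [] i _ _ = refl
indexOf-map f g x (y ∷ S) i gfx inv rewrite ≡ᵇ-injectiveOn f g gfx (inv (here refl)) with x ≡ᵇ y
... | true = refl
... | false = indexOf-map f g x S (suc i) gfx (inv ∘ there)

stdGo-map : ∀ (f g : ℕ → ℕ) seen xs → LeftInverseOn g f seen → LeftInverseOn g f xs →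
            stdGo (map f seen) (map f xs) ≡ stdGo seen xs
stdGo-map f g seen [] _ _ = refl
stdGo-map f g seen (x ∷ xs) invS invX rewrite indexOf-map f g x seen 0 (invX (here refl)) invS
  with indexOf x seen 0
... | true , i = cong (i ∷_) (stdGo-map f g seen xs invS (invX ∘ there))
... | false , i = cong (i ∷_) (trans (cong (λ S → stdGo S (map f xs)) (sym (map-++ f seen [ x ])))
                                     (stdGo-map f g (seen ++ [ x ]) xs invS′ (invX ∘ there)))
  where
  invS′ : LeftInverseOn g f (seen ++ [ x ])
  invS′ z∈ with ∈-++⁻ seen z∈
  ... | inj₁ z∈seen = invS z∈seen
  ... | inj₂ (here refl) = invX (here refl)

std-relabel : ∀ {xs ys} → Relabelling xs ys → std xs ≡ std ys
std-relabel {xs} (relabelling f g refl inv) = sym (stdGo-map f g [] xs (λ ()) inv)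

blocks-stdGo : ∀ seen xs → blocksFrom (length seen) (stdGo seen xs) ≡ length (stdLabels seen xs)
blocks-stdGo seen [] = refl
blocks-stdGo seen (x ∷ xs) with indexOf x seen 0 | indexOf-view x seen 0
... | _ | found refl p< _ =
  trans (cong (λ k → blocksFrom k (stdGo seen xs)) (nextCount-old p<)) (blocks-stdGo seen xs)
... | _ | absent refl _ =
  trans (cong (λ k → blocksFrom k (stdGo (seen ++ [ x ]) xs))
              (trans (nextCount-new (length seen)) (sym (length-∷ʳ seen x))))
        (blocks-stdGo (seen ++ [ x ]) xs)

std≡⇒relabel : ∀ {xs ys} → std xs ≡ std ys → Relabelling xs ys
std≡⇒relabel {xs} {ys} e =
  relabel-trans (relabel-std xs) (subst (λ s → Relabelling s ys) (sym e) (relabel-sym (relabel-std ys)))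

std-∷-injective : ∀ {x y μ} → std (x ∷ μ) ≡ std (y ∷ μ) → x ∈ μ → x ≡ y
std-∷-injective e = relabel-∷-fixed (std≡⇒relabel e)

std-drop-std : ∀ l xs → std (drop l (std xs)) ≡ std (drop l xs)
std-drop-std l xs = std-relabel (relabel-drop l (relabel-sym (relabel-std xs)))

-- Arcs and the alignment gain of a new first element

nextSame≡indexOf : ∀ b cs j → nextSame b cs j ≡ indexOf b cs j
nextSame≡indexOf b [] j = refl
nextSame≡indexOf b (c ∷ cs) j with b ≡ᵇ c
... | true = refl
... | false = nextSame≡indexOf b cs (suc j)

nextSame-view : ∀ b cs j → IndexOf b cs j (nextSame b cs j)
nextSame-view b cs j = subst (IndexOf b cs j) (sym (nextSame≡indexOf b cs j)) (indexOf-view b cs j)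

nextSame-suc : ∀ b cs j → nextSame b cs (suc j) ≡ Product.map₂ suc (nextSame b cs j)
nextSame-suc b [] j = refl
nextSame-suc b (c ∷ cs) j with b ≡ᵇ c
... | true = refl
... | false = nextSame-suc b cs (suc j)

shiftArc : ℕ × ℕ → ℕ × ℕ
shiftArc (i , j) = suc i , suc j

consArc : ℕ → Bool × ℕ → List (ℕ × ℕ) → List (ℕ × ℕ)
consArc i (true , j) A = (i , j) ∷ A
consArc i (false , _) A = A

arcsFrom-∷ : ∀ i x xs → arcsFrom i (x ∷ xs) ≡ consArc i (nextSame x xs (suc i)) (arcsFrom (suc i) xs)
arcsFrom-∷ i x xs with nextSame x xs (suc i)
... | true , _ = refl
... | false , _ = refl

arcsFrom-suc : ∀ i xs → arcsFrom (suc i) xs ≡ map shiftArc (arcsFrom i xs)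
arcsFrom-suc i [] = refl
arcsFrom-suc i (b ∷ bs) rewrite nextSame-suc b bs (suc i) with nextSame b bs (suc i)
... | true , _ = cong (_ ∷_) (arcsFrom-suc (suc i) bs)
... | false , _ = arcsFrom-suc (suc i) bs

countAl-shift : ∀ a bs → countAl (shiftArc a) (map shiftArc bs) ≡ countAl a bs
countAl-shift a [] = refl
countAl-shift a (b ∷ bs) = cong (_ +_) (countAl-shift a bs)

alPairs-shift : ∀ as → alPairs (map shiftArc as) ≡ alPairs as
alPairs-shift [] = refl
alPairs-shift (a ∷ as) = cong₂ _+_ (countAl-shift a as) (alPairs-shift as)

alPairs-arcsFrom-1 : ∀ xs → alPairs (arcsFrom 1 xs) ≡ al xs
alPairs-arcsFrom-1 xs = trans (cong alPairs (arcsFrom-suc 0 xs)) (alPairs-shift (arcs xs))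

length-arcsFrom-1 : ∀ xs → length (arcsFrom 1 xs) ≡ length (arcs xs)
length-arcsFrom-1 xs = trans (cong length (arcsFrom-suc 0 xs)) (length-map shiftArc (arcs xs))

newAlignments : Bool × ℕ → List (ℕ × ℕ) → ℕ
newAlignments (true , q) A = countAl (0 , q) A
newAlignments (false , _) A = 0

gain : ℕ → List ℕ → ℕ
gain x xs = newAlignments (nextSame x xs 1) (arcsFrom 1 xs)

al-∷ : ∀ x xs → al (x ∷ xs) ≡ gain x xs + al xs
al-∷ x xs with nextSame x xs 1
... | true , q = cong (countAl (0 , q) (arcsFrom 1 xs) +_) (alPairs-arcsFrom-1 xs)
... | false , _ = alPairs-arcsFrom-1 xs

length-arcs-∷-∈ : ∀ x xs → x ∈ xs → length (arcs (x ∷ xs)) ≡ suc (length (arcs xs))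
length-arcs-∷-∈ x xs x∈ rewrite arcsFrom-∷ 0 x xs with nextSame x xs 1 | nextSame-view x xs 1
... | _ | found _ _ _ = cong suc (length-arcsFrom-1 xs)
... | _ | absent _ x∉ = ⊥-elim (x∉ x∈)

length-arcs-∷-∉ : ∀ x xs → x ∉ xs → length (arcs (x ∷ xs)) ≡ length (arcs xs)
length-arcs-∷-∉ x xs x∉ rewrite arcsFrom-∷ 0 x xs with nextSame x xs 1 | nextSame-view x xs 1
... | _ | found _ p< at≡ = ⊥-elim (x∉ (subst (_∈ xs) at≡ (at-∈ xs p<)))
... | _ | absent _ _ = length-arcsFrom-1 xs

gain-∉ : ∀ x xs → x ∉ xs → gain x xs ≡ 0
gain-∉ x xs x∉ with nextSame x xs 1 | nextSame-view x xs 1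
... | _ | found _ p< at≡ = ⊥-elim (x∉ (subst (_∈ xs) at≡ (at-∈ xs p<)))
... | _ | absent _ _ = refl

-- an arc starting at 0 and ending at 1 is aligned with every arc to its right
gain-∷-self : ∀ y xs → gain y (y ∷ xs) ≡ length (arcs (y ∷ xs))
gain-∷-self y xs rewrite ≡ᵇ-refl y | arcsFrom-suc 0 (y ∷ xs) = aligned-with-all (arcs (y ∷ xs))
  where
  aligned-with-all : ∀ A → countAl (0 , 1) (map shiftArc A) ≡ length A
  aligned-with-all [] = refl
  aligned-with-all ((i , j) ∷ A) with i <ᵇ j
  ... | true = cong suc (aligned-with-all A)
  ... | false = cong suc (aligned-with-all A)

alignment-0-1 : ∀ q r → q ≢ r → alignment (0 , suc (suc q)) (1 , suc (suc r)) ≡ false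
alignment-0-1 q r q≢r with q <ᵇ r | <ᵇ-reflects-< q r
... | true | _ = refl
... | false | ofⁿ q≮r with r <ᵇ q | <ᵇ-reflects-< r q
...   | true | _ = refl
...   | false | ofⁿ r≮q = ⊥-elim (q≢r (≤-antisym (≮⇒≥ r≮q) (≮⇒≥ q≮r)))

countAl-shift² : ∀ q A → countAl (0 , suc q) (map shiftArc (map shiftArc A)) ≡ countAl (0 , q) (map shiftArc A)
countAl-shift² q [] = refl
countAl-shift² q (a ∷ A) = cong (_ +_) (countAl-shift² q A)

-- the new arc from position 1 crosses or nests the one from position 0; other arcs are just shifted
gain-∷-other : ∀ x y xs → x ≢ y → gain x (y ∷ xs) ≡ gain x xs
gain-∷-other x y xs x≢y
  rewrite ≢⇒≡ᵇ-false x≢y | nextSame-suc x xs 1 | arcsFrom-∷ 1 y xs | arcsFrom-suc 1 xs | arcsFrom-suc 0 xs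
  with nextSame x xs 1 | nextSame-view x xs 1
... | _ | absent _ _ = refl
... | _ | found {px} refl _ at-px with nextSame y xs 2 | nextSame-view y xs 2
...   | _ | absent _ _ = countAl-shift² (suc px) (arcs xs)
...   | _ | found {py} refl _ at-py
  rewrite alignment-0-1 px py (λ px≡py → x≢y (trans (sym at-px) (trans (cong (at xs) px≡py) at-py))) =
  countAl-shift² (suc px) (arcs xs)

nextSame-map : ∀ (f g : ℕ → ℕ) b cs j → g (f b) ≡ b → LeftInverseOn g f cs →
               nextSame (f b) (map f cs) j ≡ nextSame b cs j
nextSame-map f g b cs j gfb inv =
  trans (nextSame≡indexOf (f b) (map f cs) j) (trans (indexOf-map f g b cs j gfb inv) (sym (nextSame≡indexOf b cs j)))

arcsFrom-map : ∀ (f g : ℕ → ℕ) i xs → LeftInverseOn g f xs → arcsFrom i (map f xs) ≡ arcsFrom i xs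
arcsFrom-map f g i [] _ = refl
arcsFrom-map f g i (b ∷ bs) inv rewrite nextSame-map f g b bs (suc i) (inv (here refl)) (inv ∘ there)
  with nextSame b bs (suc i)
... | true , _ = cong (_ ∷_) (arcsFrom-map f g (suc i) bs (inv ∘ there))
... | false , _ = arcsFrom-map f g (suc i) bs (inv ∘ there)

gain-map : ∀ (f g : ℕ → ℕ) x xs → g (f x) ≡ x → LeftInverseOn g f xs → gain (f x) (map f xs) ≡ gain x xs
gain-map f g x xs gfx inv = cong₂ newAlignments (nextSame-map f g x xs 1 gfx inv) (arcsFrom-map f g 1 xs inv)

dedup : List ℕ → List ℕ
dedup = deduplicate _≟_

-- stated as in deduplicate, so that dedup (x ∷ xs) reduces to x ∷ remove x (dedup xs)
remove : ℕ → List ℕ → List ℕ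
remove x = filter (λ z → ¬? (x ≟ z))

dedup-unique : ∀ xs → Unique (dedup xs)
dedup-unique = deduplicate-! _≟_

∈-dedup⁺ : ∀ {xs z} → z ∈ xs → z ∈ dedup xs
∈-dedup⁺ = ∈-deduplicate⁺ _≟_

∈-dedup⁻ : ∀ xs {z} → z ∈ dedup xs → z ∈ xs
∈-dedup⁻ = ∈-deduplicate⁻ _≟_

∈-remove⁻ : ∀ x L {z} → z ∈ remove x L → x ≢ z
∈-remove⁻ x L z∈ = proj₂ (∈-filter⁻ (λ z → ¬? (x ≟ z)) {xs = L} z∈)

remove-∉ : ∀ x L → x ∉ L → remove x L ≡ L
remove-∉ x L x∉ = filter-all (λ z → ¬? (x ≟ z)) (All.tabulate λ z∈ x≡z → x∉ (subst (_∈ L) (sym x≡z) z∈))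

remove-∷-self : ∀ x L → remove x (x ∷ L) ≡ remove x L
remove-∷-self x L = filter-reject (λ z → ¬? (x ≟ z)) (λ x≢x → x≢x refl)

remove-∷-other : ∀ x y L → x ≢ y → remove x (y ∷ L) ≡ y ∷ remove x L
remove-∷-other x y L = filter-accept (λ z → ¬? (x ≟ z))

length-remove : ∀ x L → Unique L → x ∈ L → suc (length (remove x L)) ≡ length L
length-remove x (y ∷ L) (y∉L AllPairs.∷ _) (here refl) =
  cong suc (trans (cong length (remove-∷-self y L)) (cong length (remove-∉ y L (λ y∈ → All.lookup y∉L y∈ refl))))
length-remove x (y ∷ L) (y∉L AllPairs.∷ !L) (there x∈L) =
  cong suc (trans (cong length (remove-∷-other x y L (λ x≡y → All.lookup y∉L x∈L (sym x≡y))))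
                  (length-remove x L !L x∈L))

remove-map : ∀ (f g : ℕ → ℕ) x L → g (f x) ≡ x → LeftInverseOn g f L → remove (f x) (map f L) ≡ map f (remove x L)
remove-map f g x [] _ _ = refl
remove-map f g x (y ∷ L) gfx inv rewrite ≡ᵇ-injectiveOn f g gfx (inv (here refl)) with x ≡ᵇ y
... | true = remove-map f g x L gfx (inv ∘ there)
... | false = cong (f y ∷_) (remove-map f g x L gfx (inv ∘ there))

dedup-map : ∀ (f g : ℕ → ℕ) xs → LeftInverseOn g f xs → dedup (map f xs) ≡ map f (dedup xs)
dedup-map f g [] _ = refl
dedup-map f g (x ∷ xs) inv = cong (f x ∷_)
  (trans (cong (remove (f x)) (dedup-map f g xs (inv ∘ there)))
         (remove-map f g x (dedup xs) (inv (here refl)) (inv ∘ there ∘ ∈-dedup⁻ xs)))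

removals-map : ∀ (h : ℕ → ℕ) L → Unique L →
               map (λ x → h x , map h (remove x L)) L ≡ removals (map h L)
removals-map h [] _ = refl
removals-map h (y ∷ L) (y∉L AllPairs.∷ !L) = cong₂ _∷_
  (cong (λ r → h y , map h r) (trans (remove-∷-self y L) (remove-∉ y L (λ y∈ → All.lookup y∉L y∈ refl))))
  (begin
    map (λ x → h x , map h (remove x (y ∷ L))) L
      ≡⟨ map-cong-local (All.tabulate λ x∈ →
           cong (λ r → h _ , map h r) (remove-∷-other _ y L (≢-sym (All.lookup y∉L x∈)))) ⟩
    map (λ x → h x , h y ∷ map h (remove x L)) L
      ≡⟨ map-∘ L ⟩
    map (Product.map₂ (h y ∷_)) (map (λ x → h x , map h (remove x L)) L)
      ≡⟨ cong (map _) (removals-map h L !L) ⟩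
    map (Product.map₂ (h y ∷_)) (removals (map h L)) ∎)
  where open ≡-Reasoning

blocks-dedup : ∀ μ → RGFFrom 0 μ → blocks μ ≡ length (dedup μ)
blocks-dedup μ rgf = begin
  blocks μ                 ≡⟨ cong blocks (sym (std-RGF μ rgf)) ⟩
  blocks (std μ)           ≡⟨ blocks-stdGo [] μ ⟩
  length (stdLabels [] μ)  ≡⟨ ↭-length (unique-∈⇔⇒↭ (stdLabels-unique [] μ AllPairs.[]) (dedup-unique μ) to from) ⟩
  length (dedup μ)         ∎
  where
  open ≡-Reasoning
  to : ∀ {z} → z ∈ stdLabels [] μ → z ∈ dedup μ
  to z∈ = [ (λ ()) , ∈-dedup⁺ ]′ (∈-stdLabels⁻ [] μ z∈)
  from : ∀ {z} → z ∈ dedup μ → z ∈ stdLabels [] μ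
  from z∈ = ∈-stdLabels⁺ [] μ (∈-dedup⁻ μ z∈)

length-arcs+dedup : ∀ xs → length (arcs xs) + length (dedup xs) ≡ length xs
length-arcs+dedup [] = refl
length-arcs+dedup (x ∷ xs) with x ∈? xs
... | yes x∈ rewrite length-arcs-∷-∈ x xs x∈ | length-remove x (dedup xs) (dedup-unique xs) (∈-dedup⁺ x∈) =
  cong suc (length-arcs+dedup xs)
... | no x∉ rewrite length-arcs-∷-∉ x xs x∉ | remove-∉ x (dedup xs) (x∉ ∘ ∈-dedup⁻ xs) =
  trans (+-suc (length (arcs xs)) (length (dedup xs))) (cong suc (length-arcs+dedup xs))

fresh : List ℕ → ℕ
fresh xs = suc (sum xs)

fresh-∉ : ∀ xs → fresh xs ∉ xs
fresh-∉ xs fresh∈ = <-irrefl refl (s≤s (∈⇒≤sum xs fresh∈))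
  where
  ∈⇒≤sum : ∀ ys {z} → z ∈ ys → z ≤ sum ys
  ∈⇒≤sum (y ∷ ys) (here refl) = m≤m+n y (sum ys)
  ∈⇒≤sum (y ∷ ys) (there z∈) = ≤-trans (∈⇒≤sum ys z∈) (m≤n+m (sum ys) y)

-- Profiles

gains : List ℕ → List ℕ
gains xs = map (λ x → gain x xs) (dedup xs)

record Profile : Set where
  constructor mkProfile
  field
    alignments : ℕ
    arcCount : ℕ
    sortedGains : List ℕ

open Profile

mkProfile-cong : ∀ {a a′ A A′ S S′} → a ≡ a′ → A ≡ A′ → S ≡ S′ → mkProfile a A S ≡ mkProfile a′ A′ S′
mkProfile-cong refl refl refl = refl

profile : List ℕ → Profile
profile xs = mkProfile (al xs) (length (arcs xs)) (sort (gains xs))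

blockCount : Profile → ℕ
blockCount p = length (sortedGains p)

newBlockProfile : Profile → Profile
newBlockProfile (mkProfile a A S) = mkProfile a A (sort (A ∷ S))

joinProfile : Profile → ℕ → List ℕ → Profile
joinProfile (mkProfile a A _) c rest = mkProfile (c + a) (suc A) (sort (suc A ∷ rest))

joinProfile-resp-↭ : ∀ p c {r r′} → r ↭ r′ → joinProfile p c r ≡ joinProfile p c r′
joinProfile-resp-↭ (mkProfile a A _) c r↭r′ = cong (mkProfile (c + a) (suc A)) (sort-↭⇒≡ (prep (suc A) r↭r′))

gains-map : ∀ (f g : ℕ → ℕ) xs → LeftInverseOn g f xs → gains (map f xs) ≡ gains xs
gains-map f g xs inv = begin
  map (λ y → gain y (map f xs)) (dedup (map f xs)) ≡⟨ cong (map _) (dedup-map f g xs inv) ⟩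
  map (λ y → gain y (map f xs)) (map f (dedup xs)) ≡⟨ map-∘ (dedup xs) ⟨
  map (λ x → gain (f x) (map f xs)) (dedup xs)     ≡⟨ map-cong-local (All.tabulate λ x∈ →
                                                        gain-map f g _ xs (inv (∈-dedup⁻ xs x∈)) inv) ⟩
  gains xs                                         ∎
  where open ≡-Reasoning

profile-relabel : ∀ {xs ys} → Relabelling xs ys → profile xs ≡ profile ys
profile-relabel {xs} (relabelling f g refl inv) = sym (mkProfile-cong
  (cong alPairs (arcsFrom-map f g 0 xs inv))
  (cong length (arcsFrom-map f g 0 xs inv))
  (cong sort (gains-map f g xs inv)))

profile-std : ∀ xs → profile (std xs) ≡ profile xs
profile-std xs = sym (profile-relabel (relabel-std xs))

gains-∷-∉ : ∀ x xs → x ∉ xs → gains (x ∷ xs) ≡ length (arcs xs) ∷ gains xs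
gains-∷-∉ x xs x∉ = cong₂ _∷_ (trans (gain-∷-self x xs) (length-arcs-∷-∉ x xs x∉)) (begin
  map (λ z → gain z (x ∷ xs)) (remove x (dedup xs)) ≡⟨ cong (map _) (remove-∉ x (dedup xs) (x∉ ∘ ∈-dedup⁻ xs)) ⟩
  map (λ z → gain z (x ∷ xs)) (dedup xs)            ≡⟨ map-cong-local (All.tabulate λ z∈ → gain-∷-other _ x xs
                                                         λ z≡x → x∉ (subst (_∈ xs) z≡x (∈-dedup⁻ xs z∈))) ⟩
  gains xs                                          ∎)
  where open ≡-Reasoning

profile-∷-∉ : ∀ x xs → x ∉ xs → profile (x ∷ xs) ≡ newBlockProfile (profile xs)
profile-∷-∉ x xs x∉ = mkProfile-cong
  (trans (al-∷ x xs) (cong (_+ al xs) (gain-∉ x xs x∉)))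
  (length-arcs-∷-∉ x xs x∉)
  (trans (cong sort (gains-∷-∉ x xs x∉)) (sort-↭⇒≡ (prep _ (↭-sym (sort-↭ (gains xs))))))

profile-∷-∈ : ∀ x xs → x ∈ xs →
  profile (x ∷ xs) ≡ joinProfile (profile xs) (gain x xs) (map (λ z → gain z xs) (remove x (dedup xs)))
profile-∷-∈ x xs x∈ = mkProfile-cong (al-∷ x xs) (length-arcs-∷-∈ x xs x∈) (cong sort (cong₂ _∷_
  (trans (gain-∷-self x xs) (length-arcs-∷-∈ x xs x∈))
  (map-cong-local (All.tabulate λ z∈ → gain-∷-other _ x xs (≢-sym (∈-remove⁻ x (dedup xs) z∈))))))

childProfiles : Profile → List Profile
childProfiles p = newBlockProfile p ∷ map (uncurry (joinProfile p)) (removals (sortedGains p))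

-- The tree of partitions

-- the new element 1 forms a singleton block or joins a block of μ
children : List ℕ → List (List ℕ)
children μ = std (fresh μ ∷ μ) ∷ map (λ x → std (x ∷ μ)) (dedup μ)

profiles-joins : ∀ μ →
  map profile (map (λ x → std (x ∷ μ)) (dedup μ)) ≡ map (uncurry (joinProfile (profile μ))) (removals (gains μ))
profiles-joins μ = begin
  map profile (map (λ x → std (x ∷ μ)) (dedup μ))
    ≡⟨ map-∘ (dedup μ) ⟨
  map (λ x → profile (std (x ∷ μ))) (dedup μ)
    ≡⟨ map-cong-local (All.tabulate λ {x} x∈ → trans (profile-std (x ∷ μ)) (profile-∷-∈ x μ (∈-dedup⁻ μ x∈))) ⟩
  map (λ x → joinProfile (profile μ) (gain x μ) (map (λ z → gain z μ) (remove x (dedup μ)))) (dedup μ)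
    ≡⟨ map-∘ (dedup μ) ⟩
  map (uncurry (joinProfile (profile μ))) (map (λ x → gain x μ , map (λ z → gain z μ) (remove x (dedup μ))) (dedup μ))
    ≡⟨ cong (map (uncurry (joinProfile (profile μ)))) (removals-map (λ z → gain z μ) (dedup μ) (dedup-unique μ)) ⟩
  map (uncurry (joinProfile (profile μ))) (removals (gains μ))
    ∎
  where open ≡-Reasoning

profiles-children : ∀ μ → map profile (children μ) ↭ childProfiles (profile μ)
profiles-children μ = begin
  map profile (children μ)
    ≡⟨ cong₂ _∷_ (trans (profile-std (fresh μ ∷ μ)) (profile-∷-∉ (fresh μ) μ (fresh-∉ μ))) (profiles-joins μ) ⟩
  newBlockProfile (profile μ) ∷ map (uncurry (joinProfile (profile μ))) (removals (gains μ))
    <⟨ removals-↭ (joinProfile (profile μ)) (joinProfile-resp-↭ (profile μ)) (↭-sym (sort-↭ (gains μ))) ⟩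
  childProfiles (profile μ)
    ∎
  where open PermutationReasoning

∈-children⁻ : ∀ μ {ν} → ν ∈ children μ → ∃[ x ] ν ≡ std (x ∷ μ)
∈-children⁻ μ (here refl) = fresh μ , refl
∈-children⁻ μ (there ν∈) with x , _ , refl ← ∈-map⁻ (λ x → std (x ∷ μ)) ν∈ = x , refl

std-∷-∈-children : ∀ b ν → std (b ∷ ν) ∈ children (std ν)
std-∷-∈-children b ν with b ∈? ν
... | yes b∈ with y , y∈ , r ← relabel-∷-∈ (relabel-std ν) b∈ =
  there (subst (_∈ map (λ x → std (x ∷ std ν)) (dedup (std ν))) (sym (std-relabel r))
               (∈-map⁺ (λ x → std (x ∷ std ν)) (∈-dedup⁺ y∈)))
... | no b∉ = here (std-relabel (relabel-∷-∉ (relabel-std ν) b∉ (fresh-∉ (std ν))))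

children-unique : ∀ μ → Unique (children μ)
children-unique μ = All.tabulate fresh-first AllPairs.∷
  unique-mapOn (λ x → std (x ∷ μ)) (dedup-unique μ) (λ x∈ _ e → std-∷-injective e (∈-dedup⁻ μ x∈))
  where
  fresh-first : ∀ {ν} → ν ∈ map (λ x → std (x ∷ μ)) (dedup μ) → std (fresh μ ∷ μ) ≢ ν
  fresh-first ν∈ e with y , y∈ , refl ← ∈-map⁻ (λ x → std (x ∷ μ)) ν∈ =
    fresh-∉ μ (subst (_∈ μ) (std-∷-injective (sym e) (∈-dedup⁻ μ y∈)) (∈-dedup⁻ μ y∈))

InLevel : List ℕ → ℕ → List ℕ → Set
InLevel lam l μ = (RGFFrom 0 μ × length μ ≡ length lam + l) × std (drop l μ) ≡ lam

∈-level⁻ : ∀ lam l {μ} → μ ∈ level lam l → InLevel lam l μ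
∈-level⁻ lam l μ∈ with μ∈parts , std≡ ← ∈-filter⁻ (λ μ → ≡-dec _≟_ (std (drop l μ)) lam) μ∈ =
  ∈-rgfsFrom⁻ (length lam + l) 0 μ∈parts , std≡

∈-level⁺ : ∀ lam l {μ} → InLevel lam l μ → μ ∈ level lam l
∈-level⁺ lam l {μ} ((rgf , len) , std≡) =
  ∈-filter⁺ (λ μ → ≡-dec _≟_ (std (drop l μ)) lam) (subst (λ n → μ ∈ rgfsFrom n 0) len (∈-rgfsFrom⁺ 0 μ rgf)) std≡

level-unique : ∀ lam l → Unique (level lam l)
level-unique lam l = Unique.filter⁺ (λ μ → ≡-dec _≟_ (std (drop l μ)) lam) (rgfsFrom-unique (length lam + l) 0)

level-zero : ∀ lam → RGFFrom 0 lam → level lam 0 ↭ [ lam ]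
level-zero lam rgf = unique-∈⇔⇒↭ (level-unique lam 0) (All.[] AllPairs.∷ AllPairs.[]) to from
  where
  to : ∀ {μ} → μ ∈ level lam 0 → μ ∈ [ lam ]
  to μ∈ with (rgf′ , _) , std≡ ← ∈-level⁻ lam 0 μ∈ = here (trans (sym (std-RGF _ rgf′)) std≡)
  from : ∀ {μ} → μ ∈ [ lam ] → μ ∈ level lam 0
  from (here refl) = ∈-level⁺ lam 0 ((rgf , sym (+-identityʳ _)) , std-RGF lam rgf)

level-suc⁺ : ∀ lam l {ν} → ν ∈ level lam (suc l) → ν ∈ concatMap children (level lam l)
level-suc⁺ lam l {[]} ν∈ with (_ , len) , _ ← ∈-level⁻ lam (suc l) ν∈ = ⊥-elim (0≢1+n (trans len (+-suc _ l)))
level-suc⁺ lam l {b ∷ ν} ν∈ with (rgf , len) , std≡ ← ∈-level⁻ lam (suc l) ν∈ =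
  ∈-concatMap⁺′ children
    (∈-level⁺ lam l ((stdGo-RGF [] ν , trans (length-std ν) (suc-injective (trans len (+-suc _ l))))
                    , trans (std-drop-std l ν) std≡))
    (subst (_∈ children (std ν)) (std-RGF (b ∷ ν) rgf) (std-∷-∈-children b ν))

level-suc⁻ : ∀ lam l {ν} → ν ∈ concatMap children (level lam l) → ν ∈ level lam (suc l)
level-suc⁻ lam l ν∈
  with μ , μ∈ , ν∈′ ← ∈-concatMap⁻′ children (level lam l) ν∈
  with x , refl ← ∈-children⁻ μ ν∈′
  with (rgf , len) , std≡ ← ∈-level⁻ lam l μ∈ =
  ∈-level⁺ lam (suc l) ((stdGo-RGF [] (x ∷ μ) , trans (length-std (x ∷ μ)) (trans (cong suc len) (sym (+-suc _ l))))
                       , trans (std-drop-std (suc l) (x ∷ μ)) std≡)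

level-suc : ∀ lam l → level lam (suc l) ↭ concatMap children (level lam l)
level-suc lam l = unique-∈⇔⇒↭ (level-unique lam (suc l))
  (unique-concatMap children (std ∘ drop 1) (level-unique lam l) (λ _ → children-unique _) parent)
  (level-suc⁺ lam l) (level-suc⁻ lam l)
  where
  parent : ∀ {μ ν} → μ ∈ level lam l → ν ∈ children μ → std (drop 1 ν) ≡ μ
  parent {μ} μ∈ ν∈ with x , refl ← ∈-children⁻ μ ν∈ with (rgf , _) , _ ← ∈-level⁻ lam l μ∈ =
    trans (std-drop-std 1 (x ∷ μ)) (std-RGF μ rgf)

-- Profiles along the tree

descendantProfiles : ℕ → Profile → List Profile
descendantProfiles zero p = [ p ]
descendantProfiles (suc l) p = concatMap childProfiles (descendantProfiles l p)

profiles-level : ∀ lam → RGFFrom 0 lam → ∀ l → map profile (level lam l) ↭ descendantProfiles l (profile lam)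
profiles-level lam rgf zero = ↭ₚ.map⁺ profile (level-zero lam rgf)
profiles-level lam rgf (suc l) = begin
  map profile (level lam (suc l))                      ↭⟨ ↭ₚ.map⁺ profile (level-suc lam l) ⟩
  map profile (concatMap children (level lam l))       ≡⟨ map-concatMap profile children (level lam l) ⟩
  concatMap (map profile ∘ children) (level lam l)     ↭⟨ concatMap-cong-↭ profiles-children (level lam l) ⟩
  concatMap (childProfiles ∘ profile) (level lam l)    ≡⟨ concatMap-map childProfiles profile (level lam l) ⟨
  concatMap childProfiles (map profile (level lam l))  ↭⟨ concatMap-resp-↭ childProfiles (profiles-level lam rgf l) ⟩
  descendantProfiles (suc l) (profile lam)             ∎
  where open PermutationReasoning

alLevel-profiles : ∀ lam → RGFFrom 0 lam → ∀ l → alLevel lam l ↭ map alignments (descendantProfiles l (profile lam))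
alLevel-profiles lam rgf l =
  ↭-trans (↭-reflexive (map-∘ (level lam l))) (↭ₚ.map⁺ alignments (profiles-level lam rgf l))

alignments-childProfiles : ∀ p →
  map alignments (childProfiles p) ≡ alignments p ∷ map (_+ alignments p) (sortedGains p)
alignments-childProfiles p@(mkProfile a A S) = cong (a ∷_) (begin
  map alignments (map (uncurry (joinProfile p)) (removals S)) ≡⟨ map-∘ (removals S) ⟨
  map (λ (c , _) → c + a) (removals S)                        ≡⟨ map-∘ (removals S) ⟩
  map (_+ a) (map proj₁ (removals S))                         ≡⟨ cong (map (_+ a)) (map-proj₁-removals S) ⟩
  map (_+ a) S                                                ∎)
  where open ≡-Reasoning

alLevel-1 : ∀ μ → RGFFrom 0 μ → alLevel μ 1 ↭ al μ ∷ map (_+ al μ) (sortedGains (profile μ))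
alLevel-1 μ rgf = ↭-trans (alLevel-profiles μ rgf 1) (↭-reflexive (begin
  map alignments (childProfiles (profile μ) ++ [])  ≡⟨ cong (map alignments) (++-identityʳ (childProfiles (profile μ))) ⟩
  map alignments (childProfiles (profile μ))        ≡⟨ alignments-childProfiles (profile μ) ⟩
  al μ ∷ map (_+ al μ) (sortedGains (profile μ))    ∎))
  where open ≡-Reasoning

blockCount-profile : ∀ μ → blockCount (profile μ) ≡ length (dedup μ)
blockCount-profile μ = trans (↭-length (sort-↭ (gains μ))) (length-map _ (dedup μ))

profile-determined : ∀ lam pi → RGFFrom 0 lam → RGFFrom 0 pi → length lam ≡ length pi →
                     ((l : ℕ) → l ≤ 1 → alLevel lam l ↭ alLevel pi l) → profile lam ≡ profile pi
profile-determined lam pi rgfλ rgfπ len agree = mkProfile-cong al≡ arcs≡ (sort-↭⇒≡ gains↭)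
  where
  al≡ : al lam ≡ al pi
  al≡ = ∷-injectiveˡ (↭-singleton-inv (↭-trans (↭-sym (alLevel-profiles lam rgfλ 0))
                                               (↭-trans (agree 0 z≤n) (alLevel-profiles pi rgfπ 0))))
  sorted↭ : sortedGains (profile lam) ↭ sortedGains (profile pi)
  sorted↭ = map-+-cancel-↭ (al lam) (↭ₚ.drop-∷ (↭-trans (↭-sym (alLevel-1 lam rgfλ))
    (↭-trans (agree 1 (s≤s z≤n)) (subst (λ a → alLevel pi 1 ↭ a ∷ map (_+ a) _) (sym al≡) (alLevel-1 pi rgfπ)))))
  gains↭ : gains lam ↭ gains pi
  gains↭ = ↭-trans (↭-sym (sort-↭ (gains lam))) (↭-trans sorted↭ (sort-↭ (gains pi)))
  blocks≡ : length (dedup lam) ≡ length (dedup pi)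
  blocks≡ = trans (sym (blockCount-profile lam)) (trans (↭-length sorted↭) (blockCount-profile pi))
  arcs≡ : length (arcs lam) ≡ length (arcs pi)
  arcs≡ = +-cancelʳ-≡ (length (dedup lam)) _ _ (trans (length-arcs+dedup lam)
            (trans len (trans (sym (length-arcs+dedup pi)) (cong (length (arcs pi) +_) (sym blocks≡)))))

alignmentsWithBlocks : ℕ → List Profile → List ℕ
alignmentsWithBlocks m ps = map alignments (filter (λ p → blockCount p ≟ m) ps)

alLevelBlocks-profiles : ∀ lam l m → alLevelBlocks lam l m ≡ alignmentsWithBlocks m (map profile (level lam l))
alLevelBlocks-profiles lam l m = go (level lam l) (All.tabulate λ μ∈ → proj₁ (proj₁ (∈-level⁻ lam l μ∈)))
  where
  go : ∀ L → All (RGFFrom 0) L → map al (filter (λ μ → blocks μ ≟ m) L) ≡ alignmentsWithBlocks m (map profile L)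
  go [] _ = refl
  go (μ ∷ L) (rgf All.∷ rgfs) rewrite blocks-dedup μ rgf | blockCount-profile μ with length (dedup μ) ≡ᵇ m
  ... | true = cong (al μ ∷_) (go L rgfs)
  ... | false = go L rgfs

corollary3p3 : (n k : ℕ) (lam pi : List ℕ) →
    IsPartition n lam → IsPartition n pi →
    blocks lam ≡ k → blocks pi ≡ k →
    ((l : ℕ) → l ≤ 1 → alLevel lam l ↭ alLevel pi l) →
    (l m : ℕ) → alLevelBlocks lam l m ↭ alLevelBlocks pi l m
corollary3p3 n k lam pi (len-lam , rgf-lam) (len-pi , rgf-pi) _ _ agree l m = begin
  alLevelBlocks lam l m
    ≡⟨ alLevelBlocks-profiles lam l m ⟩
  alignmentsWithBlocks m (map profile (level lam l))
    ↭⟨ restrict (profiles-level lam rgf-lam l) ⟩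
  alignmentsWithBlocks m (descendantProfiles l (profile lam))
    ≡⟨ cong (alignmentsWithBlocks m ∘ descendantProfiles l) same-profile ⟩
  alignmentsWithBlocks m (descendantProfiles l (profile pi))
    ↭⟨ restrict (profiles-level pi rgf-pi l) ⟨
  alignmentsWithBlocks m (map profile (level pi l))
    ≡⟨ alLevelBlocks-profiles pi l m ⟨
  alLevelBlocks pi l m
    ∎
  where
  open PermutationReasoning
  same-profile : profile lam ≡ profile pi
  same-profile = profile-determined lam pi rgf-lam rgf-pi (trans len-lam (sym len-pi)) agree
  restrict : ∀ {ps qs} → ps ↭ qs → alignmentsWithBlocks m ps ↭ alignmentsWithBlocks m qs
  restrict = ↭ₚ.map⁺ alignments ∘ ↭ₚ.filter-↭ (λ p → blockCount p ≟ m)
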